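{- For any set of formulas $\Sigma$ and formulas $A,B$: if $\Sigma;\emptyset\vdash B\to\Box(A\wedge B)$, then $\Sigma;\emptyset\vdash B\to\Box^+A$.
   Context: Formulas are built from propositional variables and $\bot$ by $\to$, $\Box$, $\Box^+$ ($\neg A:=A\to\bot$, $A\wedge B:=\neg(A\to\neg B)$). $\mathsf{K}^+$ has axioms: classical tautologies; $\Box(A\to B)\to(\Box A\to\Box B)$; $\Box^+(A\to B)\to(\Box^+A\to\Box^+B)$; $\Box^+A\to\Box A\wedge\Box\Box^+A$; $\Box A\wedge\Box^+(A\to\Box A)\to\Box^+A$; rules ($\mathsf{mp}$) from $A$, $A\to B$ infer $B$ and ($\mathsf{nec}$) from $A$ infer $\Box^+A$. For a finite derivation tree built by these rules, an assumption leaf is a leaf not marked by an axiom; it is boxed if the path from the root to it passes through an application of ($\mathsf{nec}$). $\Sigma;\Gamma\vdash A$ means there is such a derivation of $A$ whose boxed assumption leaves are marked by formulas in $\Sigma$ and non-boxed assumption leaves by formulas in $\Gamma$. -}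

module Defs where

open import Data.Nat using (ℕ)
open import Data.Bool using (Bool; true; false; not; _∨_)
open import Data.Empty using (⊥)
open import Relation.Binary.PropositionalEquality using (_≡_)

infixr 5 _⇒_
data Formula : Set where
  var  : ℕ → Formula
  ⊥'   : Formula
  _⇒_  : Formula → Formula → Formula
  □    : Formula → Formula
  □⁺   : Formula → Formula

¬' : Formula → Formula
¬' A = A ⇒ ⊥'

infixl 6 _∧'_
_∧'_ : Formula → Formula → Formula
A ∧' B = ¬' (A ⇒ ¬' B)

-- Classical (propositional) truth evaluation: modal formulas □A, □⁺A are
-- treated as propositional atoms, valued by the same assignment v.
eval : (Formula → Bool) → Formula → Bool
eval v (var n)  = v (var n)
eval v ⊥'       = false
eval v (A ⇒ B)  = not (eval v A) ∨ eval v B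
eval v (□ A)    = v (□ A)
eval v (□⁺ A)   = v (□⁺ A)

Tautology : Formula → Set
Tautology A = (v : Formula → Bool) → eval v A ≡ true

data Axiom : Formula → Set where
  taut  : ∀ {A} → Tautology A → Axiom A
  K□    : ∀ A B → Axiom (□ (A ⇒ B) ⇒ (□ A ⇒ □ B))
  K□⁺   : ∀ A B → Axiom (□⁺ (A ⇒ B) ⇒ (□⁺ A ⇒ □⁺ B))
  unfold : ∀ A → Axiom (□⁺ A ⇒ (□ A ∧' □ (□⁺ A)))
  induct : ∀ A → Axiom ((□ A ∧' □⁺ (A ⇒ □ A)) ⇒ □⁺ A)

FSet : Set₁
FSet = Formula → Set

∅ : FSet
∅ _ = ⊥

-- Σ ; Γ ⊢ A : a derivation tree whose non-boxed assumption leaves are in Γ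
-- and whose boxed assumption leaves (those below an application of nec) are
-- in Σ. Below nec every leaf is boxed, so the premise of nec is derived with
-- both kinds of leaves drawn from Σ.
infix 4 _⨾_⊢_
data _⨾_⊢_ (Σ Γ : FSet) : Formula → Set where
  ax  : ∀ {A} → Axiom A → Σ ⨾ Γ ⊢ A
  hyp : ∀ {A} → Γ A → Σ ⨾ Γ ⊢ A
  mp  : ∀ {A B} → Σ ⨾ Γ ⊢ A → Σ ⨾ Γ ⊢ (A ⇒ B) → Σ ⨾ Γ ⊢ B
  nec : ∀ {A} → Σ ⨾ Σ ⊢ A → Σ ⨾ Γ ⊢ □⁺ A

module Submission where

open import Defs
open import Data.Bool using (true; false)
open import Relation.Binary.PropositionalEquality using (refl)

-- With X := A ∧ B, the hypothesis gives X → □X (as X → B), hence □⁺(X → □X) by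
-- necessitation; the induction axiom then turns B → □X into B → □⁺X, and
-- □⁺ is monotone along the tautology X → A.

syllogism-taut : ∀ P Q R → Tautology ((P ⇒ Q) ⇒ ((Q ⇒ R) ⇒ (P ⇒ R)))
syllogism-taut P Q R v with eval v P | eval v Q | eval v R
... | true  | true  | true  = refl
... | true  | true  | false = refl
... | true  | false | true  = refl
... | true  | false | false = refl
... | false | true  | true  = refl
... | false | true  | false = refl
... | false | false | true  = refl
... | false | false | false = refl

∧-projˡ-taut : ∀ A B → Tautology ((A ∧' B) ⇒ A)
∧-projˡ-taut A B v with eval v A | eval v B
... | true  | true  = refl
... | true  | false = refl
... | false | true  = refl
... | false | false = refl

∧-projʳ-taut : ∀ A B → Tautology ((A ∧' B) ⇒ B)
∧-projʳ-taut A B v with eval v A | eval v B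
... | true  | true  = refl
... | true  | false = refl
... | false | true  = refl
... | false | false = refl

∧-pairʳ-taut : ∀ A B → Tautology (B ⇒ (A ⇒ (A ∧' B)))
∧-pairʳ-taut A B v with eval v A | eval v B
... | true  | true  = refl
... | true  | false = refl
... | false | true  = refl
... | false | false = refl

module _ {Σ : FSet} where

  weaken-∅ : ∀ {Γ A} → Σ ⨾ ∅ ⊢ A → Σ ⨾ Γ ⊢ A
  weaken-∅ (ax a)   = ax a
  weaken-∅ (hyp ())
  weaken-∅ (mp d e) = mp (weaken-∅ d) (weaken-∅ e)
  weaken-∅ (nec d)  = nec d

  module _ {Γ : FSet} where

    syllogism : ∀ {P Q R} → Σ ⨾ Γ ⊢ (P ⇒ Q) → Σ ⨾ Γ ⊢ (Q ⇒ R) → Σ ⨾ Γ ⊢ (P ⇒ R)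
    syllogism {P} {Q} {R} d e = mp e (mp d (ax (taut (syllogism-taut P Q R))))

    ∧-projʳ-⇒ : ∀ {A B C} → Σ ⨾ Γ ⊢ (B ⇒ C) → Σ ⨾ Γ ⊢ ((A ∧' B) ⇒ C)
    ∧-projʳ-⇒ {A} {B} = syllogism (ax (taut (∧-projʳ-taut A B)))

    ∧-introʳ-⇒ : ∀ {A B C} → Σ ⨾ Γ ⊢ (A ⇒ B) → Σ ⨾ Γ ⊢ C → Σ ⨾ Γ ⊢ (A ⇒ (B ∧' C))
    ∧-introʳ-⇒ {B = B} {C} d c = syllogism d (mp c (ax (taut (∧-pairʳ-taut B C))))

    □⁺-mono : ∀ {A B} → Σ ⨾ Σ ⊢ (A ⇒ B) → Σ ⨾ Γ ⊢ (□⁺ A ⇒ □⁺ B)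
    □⁺-mono {A} {B} d = mp (nec d) (ax (K□⁺ A B))

lemma25 : (Σ : FSet) (A B : Formula)
    → Σ ⨾ ∅ ⊢ (B ⇒ □ (A ∧' B))
    → Σ ⨾ ∅ ⊢ (B ⇒ □⁺ A)
lemma25 Σ A B d = syllogism B⇒□⁺X (□⁺-mono (ax (taut (∧-projˡ-taut A B))))
  where
    X : Formula
    X = A ∧' B

    X⇒□X : Σ ⨾ Σ ⊢ (X ⇒ □ X)
    X⇒□X = ∧-projʳ-⇒ (weaken-∅ d)

    B⇒□⁺X : Σ ⨾ ∅ ⊢ (B ⇒ □⁺ X)
    B⇒□⁺X = syllogism (∧-introʳ-⇒ d (nec X⇒□X)) (ax (induct X))
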